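{- Let $\mathfrak S$ be a finite subset of $\mathbb Z^2$, $K(x,y;t)=1-t\sum_{(i,j)\in\mathfrak S}x^iy^j$, and let $S(x,y;t)$ and $L(t)$ be the generating functions of walks on the slit plane and of loops with steps in $\mathfrak S$. There exists a series $\Omega(\bar x;t)\in\mathbb N[\bar x][[t]]$ with $\Omega(\bar x;0)=0$ such that $$K(x,y;t)S(x,y;t)=1-\Omega(\bar x;t),\qquad L(t)=\frac{1}{1-\Omega(0;t)}.$$
   Context: A walk with steps in $\mathfrak S$ is a sequence $(w_0,\dots,w_n)$ of points of $\mathbb Z^2$ with $w_0=(0,0)$ and $w_k-w_{k-1}\in\mathfrak S$; $n$ is its length. It is on the slit plane if none of $w_1,\dots,w_n$ lies on $\mathcal H=\{(k,0):k\le0\}$; it is a loop if $w_n=(0,0)$ and no $w_k$ lies on $\{(k,0):k<0\}$. The generating function of a set of walks is $\sum_nt^n\sum_{i,j}a_{i,j}(n)x^iy^j$ with $a_{i,j}(n)$ the number of its walks of length $n$ ending at $(i,j)$ (only $t$ kept for loops); $\bar x=1/x$. -}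

module Defs where

open import Data.Nat as ℕ using (ℕ; zero; suc)
open import Data.Integer as ℤ using (ℤ; +_; 0ℤ; _≤ᵇ_; ∣_∣)
open import Data.Integer.Properties using (_≟_)
open import Data.Bool using (Bool; true; false; _∧_; not; if_then_else_)
open import Data.Fin using (Fin)
open import Data.List using (List; []; _∷_; [_]; map; concatMap; allFin; filterᵇ; length; foldr)
open import Data.Bool.ListAction using (all)
open import Data.Vec as Vec using (Vec; []; _∷_; toList)
open import Data.Product using (_×_; _,_)
open import Relation.Nullary using (does)

Point : Set
Point = ℤ × ℤ

origin : Point
origin = (0ℤ , 0ℤ)

_⊕_ : Point → Point → Point
(a , b) ⊕ (c , d) = (a ℤ.+ c , b ℤ.+ d)

_==_ : ℤ → ℤ → Bool
a == b = does (a ≟ b)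

samePt : Point → Point → Bool
samePt (a , b) (c , d) = (a == c) ∧ (b == d)

inH : Point → Bool
inH (i , j) = (j == 0ℤ) ∧ (i ≤ᵇ 0ℤ)

inNegAxis : Point → Bool
inNegAxis (i , j) = (j == 0ℤ) ∧ (i ≤ᵇ ℤ.-1ℤ)

allSeqs : (m n : ℕ) → List (Vec (Fin m) n)
allSeqs m zero = [ [] ]
allSeqs m (suc n) = concatMap (λ v → map (λ s → s Vec.∷ v) (allFin m)) (allSeqs m n)

Walk : List Point → ℕ → Set
Walk 𝔖 n = Vec (Fin (length 𝔖)) n

steps : (𝔖 : List Point) {n : ℕ} → Walk 𝔖 n → List Point
steps 𝔖 w = map (Data.List.lookup 𝔖) (toList w)

positionsFrom : Point → List Point → List Point
positionsFrom p [] = []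
positionsFrom p (s ∷ ss) = (p ⊕ s) ∷ positionsFrom (p ⊕ s) ss

positions : (𝔖 : List Point) {n : ℕ} → Walk 𝔖 n → List Point
positions 𝔖 w = positionsFrom origin (steps 𝔖 w)

endpointFrom : Point → List Point → Point
endpointFrom p [] = p
endpointFrom p (s ∷ ss) = endpointFrom (p ⊕ s) ss

endpoint : (𝔖 : List Point) {n : ℕ} → Walk 𝔖 n → Point
endpoint 𝔖 w = endpointFrom origin (steps 𝔖 w)

onSlitPlane : (𝔖 : List Point) {n : ℕ} → Walk 𝔖 n → Bool
onSlitPlane 𝔖 w = all (λ p → not (inH p)) (positions 𝔖 w)

isLoop : (𝔖 : List Point) {n : ℕ} → Walk 𝔖 n → Bool
isLoop 𝔖 w = samePt (endpoint 𝔖 w) origin ∧ all (λ p → not (inNegAxis p)) (positions 𝔖 w)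

slitCount : List Point → ℕ → ℤ → ℤ → ℕ
slitCount 𝔖 n i j =
  length (filterᵇ (λ w → onSlitPlane 𝔖 w ∧ samePt (endpoint 𝔖 w) (i , j)) (allSeqs (length 𝔖) n))

loopCount : List Point → ℕ → ℕ
loopCount 𝔖 n = length (filterᵇ (isLoop 𝔖) (allSeqs (length 𝔖) n))

sumℤ : List ℤ → ℤ
sumℤ = foldr ℤ._+_ 0ℤ

-- coefficient of t^n x^i y^j in K(x,y;t) S(x,y;t), K = 1 - t Σ_{(p,q)∈𝔖} x^p y^q
KSCoeff : List Point → ℕ → ℤ → ℤ → ℤ
KSCoeff 𝔖 zero i j = + slitCount 𝔖 zero i j
KSCoeff 𝔖 (suc n) i j =
  + slitCount 𝔖 (suc n) i j
  ℤ.- sumℤ (map (λ { (p , q) → + slitCount 𝔖 n (i ℤ.- p) (j ℤ.- q) }) 𝔖)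

-- coefficient of t^n x^i y^j in 1 - Ω(x̄;t), where ω n k = [t^n x̄^k] Ω
oneMinusΩCoeff : (ℕ → ℕ → ℕ) → ℕ → ℤ → ℤ → ℤ
oneMinusΩCoeff ω n i j =
  (if samePt (i , j) origin ∧ (n ℕ.≡ᵇ 0) then + 1 else 0ℤ)
  ℤ.- (if inH (i , j) then + ω n ∣ i ∣ else 0ℤ)

-- Appending a step to a walk on the slit plane either keeps it on the slit plane or makes it
-- enter H for the first time, and ω n k counts the walks of length n of the second kind that end
-- at (−k, 0). Read coefficientwise, this last-step decomposition is K S = 1 − Ω.
-- A walk from any point p that ends at the origin and avoids the negative half-axis meets H first
-- at the origin, and from there it continues as a loop. Walks that first enter H at the origin are
-- counted by ω n 0, so this first-passage decomposition gives L = 1 + L Ω(0), i.e. L = 1/(1 − Ω(0)).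
-- It is proved for every p at once, by induction on the length and splitting off the first step.
-- Ω is a polynomial in x̄ at each order, since a walk of length n moves at most n Σ|i| horizontally.

module Submission where

open import Defs
open import Data.Nat using (ℕ; _≤_; _+_; _*_; _∸_; suc)
open import Data.List using (List; map; upTo)
open import Data.Nat.ListAction using (sum)
open import Data.List.Relation.Unary.Unique.Propositional using (Unique)
open import Data.Integer using (ℤ)
open import Data.Product using (Σ-syntax; ∃-syntax; _×_)
open import Data.Bool using (if_then_else_)
open import Relation.Binary.PropositionalEquality using (_≡_)

open import Data.Nat using (zero; _<_; _≡ᵇ_)
open import Data.Nat.Properties
  using (+-*-semiring; +-identityʳ; +-assoc; *-identityʳ; *-zeroʳ; ≤-trans; m≤m+n; m≤n+m;
         +-monoˡ-≤; +-monoʳ-≤; ≤-reflexive; <⇒≱)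
open import Data.Nat.ListAction.Properties using (sum-++)
open import Data.Nat.Tactic.RingSolver using (solve-∀)
open import Data.Integer as ℤ using (-[1+_]; 0ℤ; ∣_∣)
open import Data.Integer.Properties using (pos-+; ∣-i∣≡∣i∣; ∣i+j∣≤∣i∣+∣j∣)
import Data.Integer.Tactic.RingSolver as ℤ-Solver
open import Data.Fin using (Fin) renaming (zero to fzero; suc to fsuc)
open import Data.List using ([]; _∷_; _++_; _∷ʳ_; length; filterᵇ; concatMap; tabulate; allFin; applyUpTo; lookup)
open import Data.List.Properties using (map-++; map-cong; map-tabulate; tabulate-lookup; map-upTo)
open import Data.List.Relation.Unary.All using (All; []; _∷_)
open import Data.Bool using (Bool; true; false; _∧_; not)
open import Data.Bool.Properties using (∧-assoc; ∧-identityʳ; ∧-zeroʳ)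
open import Data.Bool.ListAction using (all)
open import Data.Product using (_,_; proj₁; proj₂)
import Data.Vec as Vec
open import Data.Empty using (⊥-elim)
open import Function using (_∘_)
open import Relation.Nullary using (yes; no; contradiction)
open import Relation.Binary.PropositionalEquality using (refl; sym; trans; cong; cong₂; subst₂; module ≡-Reasoning)
open import Algebra.Properties.Semiring.Sum +-*-semiring
  using (sum-syntax; ∑-comm; ∑-distrib-+; *-distribˡ-sum; sum-cong-≗; sum-replicate-zero)

open ≡-Reasoning

⟦_⟧ : Bool → ℕ
⟦ b ⟧ = if b then 1 else 0

⟦∧⟧ : ∀ a b → ⟦ a ∧ b ⟧ ≡ ⟦ a ⟧ * ⟦ b ⟧
⟦∧⟧ false b = refl
⟦∧⟧ true  b = sym (+-identityʳ ⟦ b ⟧)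

⟦⟧-split : ∀ b h → ⟦ b ⟧ ≡ ⟦ b ∧ not h ⟧ + ⟦ h ⟧ * ⟦ b ⟧
⟦⟧-split false false = refl
⟦⟧-split false true  = refl
⟦⟧-split true  false = refl
⟦⟧-split true  true  = refl

+⟦⟧*≡if : ∀ b n → ℤ.+ (⟦ b ⟧ * n) ≡ (if b then ℤ.+ n else 0ℤ)
+⟦⟧*≡if false n = refl
+⟦⟧*≡if true  n = cong ℤ.+_ (+-identityʳ n)

length-filterᵇ : {A : Set} (P : A → Bool) (xs : List A) → length (filterᵇ P xs) ≡ sum (map (⟦_⟧ ∘ P) xs)
length-filterᵇ P []       = refl
length-filterᵇ P (x ∷ xs) with P x
... | true  = cong suc (length-filterᵇ P xs)
... | false = length-filterᵇ P xs

sum-map-concatMap : {A B : Set} (f : B → ℕ) (g : A → List B) (xs : List A) →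
  sum (map f (concatMap g xs)) ≡ sum (map (λ x → sum (map f (g x))) xs)
sum-map-concatMap f g []       = refl
sum-map-concatMap f g (x ∷ xs) = begin
  sum (map f (g x ++ concatMap g xs))               ≡⟨ cong sum (map-++ f (g x) (concatMap g xs)) ⟩
  sum (map f (g x) ++ map f (concatMap g xs))       ≡⟨ sum-++ (map f (g x)) (map f (concatMap g xs)) ⟩
  sum (map f (g x)) + sum (map f (concatMap g xs))  ≡⟨ cong (sum (map f (g x)) +_) (sum-map-concatMap f g xs) ⟩
  sum (map f (g x)) + sum (map (λ y → sum (map f (g y))) xs) ∎

sum-map-tabulate : {A : Set} {n : ℕ} (f : A → ℕ) (g : Fin n → A) → sum (map f (tabulate g)) ≡ ∑[ i < n ] f (g i)
sum-map-tabulate {n = zero}  f g = refl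
sum-map-tabulate {n = suc n} f g = cong (f (g fzero) +_) (sum-map-tabulate f (g ∘ fsuc))

sum-map-lookup : {A : Set} (f : A → ℕ) (xs : List A) → sum (map f xs) ≡ ∑[ i < length xs ] f (lookup xs i)
sum-map-lookup f xs = trans (cong (sum ∘ map f) (sym (tabulate-lookup xs))) (sum-map-tabulate f (lookup xs))

sum-map-∑ : {A : Set} {n : ℕ} (f : A → Fin n → ℕ) (xs : List A) →
  sum (map (λ x → ∑[ i < n ] f x i) xs) ≡ ∑[ i < n ] sum (map (λ x → f x i) xs)
sum-map-∑ {n = n} f []       = sym (sum-replicate-zero n)
sum-map-∑ {n = n} f (x ∷ xs) = trans (cong (∑[ i < n ] f x i +_) (sum-map-∑ f xs)) (sym (∑-distrib-+ (f x) _))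

sumℤ-map-+ : {A : Set} (f : A → ℕ) (xs : List A) → sumℤ (map (λ x → ℤ.+ f x) xs) ≡ ℤ.+ sum (map f xs)
sumℤ-map-+ f []       = refl
sumℤ-map-+ f (x ∷ xs) = trans (cong (λ z → ℤ.+ f x ℤ.+ z) (sumℤ-map-+ f xs)) (sym (pos-+ (f x) (sum (map f xs))))

f≤∑f : {n : ℕ} (f : Fin n → ℕ) (i : Fin n) → f i ≤ ∑[ j < n ] f j
f≤∑f f fzero    = m≤m+n (f fzero) _
f≤∑f f (fsuc i) = ≤-trans (f≤∑f (f ∘ fsuc) i) (m≤n+m _ (f fzero))

infixl 7 _⋆_

_⋆_ : (ℕ → ℕ) → (ℕ → ℕ) → ℕ → ℕ
(a ⋆ b) zero    = a 0 * b 0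
(a ⋆ b) (suc n) = a 0 * b (suc n) + (a ∘ suc ⋆ b) n

sum-upTo≡⋆ : ∀ a b n → sum (map (λ k → a k * b (n ∸ k)) (upTo (suc n))) ≡ (a ⋆ b) n
sum-upTo≡⋆ a b n = trans (cong sum (map-upTo _ (suc n))) (sum-applyUpTo≡⋆ a n)
  where
  sum-applyUpTo≡⋆ : ∀ a n → sum (applyUpTo (λ k → a k * b (n ∸ k)) (suc n)) ≡ (a ⋆ b) n
  sum-applyUpTo≡⋆ a zero    = +-identityʳ (a 0 * b 0)
  sum-applyUpTo≡⋆ a (suc n) = cong (a 0 * b (suc n) +_) (sum-applyUpTo≡⋆ (a ∘ suc) n)

⋆-cong : ∀ {a a′ b b′} → (∀ k → a k ≡ a′ k) → (∀ k → b k ≡ b′ k) → ∀ n → (a ⋆ b) n ≡ (a′ ⋆ b′) n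
⋆-cong a≗a′ b≗b′ zero    = cong₂ _*_ (a≗a′ 0) (b≗b′ 0)
⋆-cong a≗a′ b≗b′ (suc n) = cong₂ _+_ (cong₂ _*_ (a≗a′ 0) (b≗b′ (suc n))) (⋆-cong (a≗a′ ∘ suc) b≗b′ n)

⋆-sucʳ : ∀ a b n → (a ⋆ b) (suc n) ≡ (a ⋆ b ∘ suc) n + a (suc n) * b 0
⋆-sucʳ a b zero    = refl
⋆-sucʳ a b (suc n) = begin
  a 0 * b (suc (suc n)) + (a ∘ suc ⋆ b) (suc n)
    ≡⟨ cong (a 0 * b (suc (suc n)) +_) (⋆-sucʳ (a ∘ suc) b n) ⟩
  a 0 * b (suc (suc n)) + ((a ∘ suc ⋆ b ∘ suc) n + a (suc (suc n)) * b 0)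
    ≡⟨ sym (+-assoc (a 0 * b (suc (suc n))) _ _) ⟩
  (a ⋆ b ∘ suc) (suc n) + a (suc (suc n)) * b 0 ∎

⋆-zeroʳ : ∀ a n → (a ⋆ (λ _ → 0)) n ≡ 0
⋆-zeroʳ a zero    = *-zeroʳ (a 0)
⋆-zeroʳ a (suc n) = cong₂ _+_ (*-zeroʳ (a 0)) (⋆-zeroʳ (a ∘ suc) n)

⋆-identityʳ : ∀ a n → (a ⋆ (λ k → ⟦ k ≡ᵇ 0 ⟧)) n ≡ a n
⋆-identityʳ a zero    = *-identityʳ (a 0)
⋆-identityʳ a (suc n) = begin
  (a ⋆ (λ k → ⟦ k ≡ᵇ 0 ⟧)) (suc n) ≡⟨ ⋆-sucʳ a (λ k → ⟦ k ≡ᵇ 0 ⟧) n ⟩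
  (a ⋆ (λ _ → 0)) n + a (suc n) * 1 ≡⟨ cong₂ _+_ (⋆-zeroʳ a n) (*-identityʳ (a (suc n))) ⟩
  a (suc n)                         ∎

⋆-linearʳ : ∀ a b c x y n → (a ⋆ (λ k → x * b k + y * c k)) n ≡ x * (a ⋆ b) n + y * (a ⋆ c) n
⋆-linearʳ a b c x y zero    = distrib (a 0) (b 0) (c 0) x y
  where
  distrib : ∀ a b c x y → a * (x * b + y * c) ≡ x * (a * b) + y * (a * c)
  distrib = solve-∀
⋆-linearʳ a b c x y (suc n) = begin
  a 0 * (x * b (suc n) + y * c (suc n)) + (a ∘ suc ⋆ (λ k → x * b k + y * c k)) n
    ≡⟨ cong (a 0 * (x * b (suc n) + y * c (suc n)) +_) (⋆-linearʳ (a ∘ suc) b c x y n) ⟩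
  a 0 * (x * b (suc n) + y * c (suc n)) + (x * (a ∘ suc ⋆ b) n + y * (a ∘ suc ⋆ c) n)
    ≡⟨ distrib (a 0) (b (suc n)) (c (suc n)) x y _ _ ⟩
  x * (a ⋆ b) (suc n) + y * (a ⋆ c) (suc n) ∎
  where
  distrib : ∀ a b c x y u v → a * (x * b + y * c) + (x * u + y * v) ≡ x * (a * b + u) + y * (a * c + v)
  distrib = solve-∀

⋆-∑ʳ : ∀ {m} a (b : Fin m → ℕ → ℕ) n → (a ⋆ (λ k → ∑[ s < m ] b s k)) n ≡ ∑[ s < m ] (a ⋆ b s) n
⋆-∑ʳ a b zero    = *-distribˡ-sum (a 0) (λ s → b s 0)
⋆-∑ʳ a b (suc n) =
  trans (cong₂ _+_ (*-distribˡ-sum (a 0) (λ s → b s (suc n))) (⋆-∑ʳ (a ∘ suc) b n))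
        (sym (∑-distrib-+ (λ s → a 0 * b s (suc n)) (λ s → (a ∘ suc ⋆ b s) n)))

==-cong : ∀ {a b c d : ℤ} → (a ≡ b → c ≡ d) → (c ≡ d → a ≡ b) → (a == b) ≡ (c == d)
==-cong {a} {b} {c} {d} to from with a ℤ.≟ b | c ℤ.≟ d
... | yes _   | yes _   = refl
... | no _    | no _    = refl
... | yes a≡b | no c≢d  = ⊥-elim (c≢d (to a≡b))
... | no a≢b  | yes c≡d = ⊥-elim (a≢b (from c≡d))

==⇒≡ : ∀ {a b : ℤ} → (a == b) ≡ true → a ≡ b
==⇒≡ {a} {b} _ with a ℤ.≟ b
==⇒≡ _  | yes a≡b = a≡b
==⇒≡ () | no _

samePt⇒≡ : ∀ {x y} → samePt x y ≡ true → x ≡ y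
samePt⇒≡ {a , b} {c , d} same with a == c in a≟c | b == d in b≟d
samePt⇒≡ _    | true | true = cong₂ _,_ (==⇒≡ a≟c) (==⇒≡ b≟d)
samePt⇒≡ ()   | true | false
samePt⇒≡ ()   | false | _

samePt-sym : ∀ x y → samePt x y ≡ samePt y x
samePt-sym (a , b) (c , d) = cong₂ _∧_ (==-cong {a} {c} sym sym) (==-cong {b} {d} sym sym)

samePt-shift : ∀ e x t → samePt e (proj₁ t ℤ.- proj₁ x , proj₂ t ℤ.- proj₂ x) ≡ samePt (e ⊕ x) t
samePt-shift (a , b) (p , q) (i , j) = cong₂ _∧_ (==-cong {a} (shift a p i) (unshift a p i)) (==-cong {b} (shift b q j) (unshift b q j))
  where
  shift : ∀ a p i → a ≡ i ℤ.- p → a ℤ.+ p ≡ i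
  shift _ p i refl = sub-add i p
    where sub-add : ∀ i p → i ℤ.- p ℤ.+ p ≡ i
          sub-add = ℤ-Solver.solve-∀
  unshift : ∀ a p i → a ℤ.+ p ≡ i → a ≡ i ℤ.- p
  unshift a p _ refl = add-sub a p
    where add-sub : ∀ a p → a ≡ a ℤ.+ p ℤ.- p
          add-sub = ℤ-Solver.solve-∀

inH⇒≡ : ∀ {x} → inH x ≡ true → x ≡ (ℤ.- (ℤ.+ ∣ proj₁ x ∣) , 0ℤ)
inH⇒≡ {ℤ.+ zero    , ℤ.+ zero}  _  = refl
inH⇒≡ { -[1+ _ ]    , ℤ.+ zero}  _  = refl
inH⇒≡ {ℤ.+ (suc _) , ℤ.+ zero}  ()
inH⇒≡ {_ , ℤ.+ (suc _)}         ()
inH⇒≡ {_ , -[1+ _ ]}            ()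

inNegAxis≡inH : ∀ {x} → samePt x origin ≡ false → inNegAxis x ≡ inH x
inNegAxis≡inH {ℤ.+ zero    , ℤ.+ zero} ()
inNegAxis≡inH {ℤ.+ (suc _) , ℤ.+ zero} _ = refl
inNegAxis≡inH { -[1+ _ ]    , ℤ.+ zero} _ = refl
inNegAxis≡inH {_ , ℤ.+ (suc _)}        _ = refl
inNegAxis≡inH {_ , -[1+ _ ]}           _ = refl

avoids : (Point → Bool) → Point → List Point → Bool
avoids A p ss = all (not ∘ A) (positionsFrom p ss)

slitTo : Point → Point → List Point → Bool
slitTo p t ss = avoids inH p ss ∧ samePt (endpointFrom p ss) t

loopFrom : Point → List Point → Bool
loopFrom p ss = samePt (endpointFrom p ss) origin ∧ avoids inNegAxis p ss

-- offHUntil q t: the points q, w₁, …, wₙ₋₁ avoid H and wₙ = t; entersHAt does not test q.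
offHUntil : Point → Point → List Point → Bool
offHUntil q t []       = samePt q t
offHUntil q t (s ∷ ss) = not (inH q) ∧ offHUntil (q ⊕ s) t ss

entersHAt : Point → Point → List Point → Bool
entersHAt p t []       = false
entersHAt p t (s ∷ ss) = offHUntil (p ⊕ s) t ss

endpointFrom-∷ʳ : ∀ p ss x → endpointFrom p (ss ∷ʳ x) ≡ endpointFrom p ss ⊕ x
endpointFrom-∷ʳ p []       x = refl
endpointFrom-∷ʳ p (s ∷ ss) x = endpointFrom-∷ʳ (p ⊕ s) ss x

avoids-∷ʳ : ∀ A p ss x → avoids A p (ss ∷ʳ x) ≡ avoids A p ss ∧ not (A (endpointFrom p ss ⊕ x))
avoids-∷ʳ A p []       x = ∧-identityʳ (not (A (p ⊕ x)))
avoids-∷ʳ A p (s ∷ ss) x = trans (cong (not (A (p ⊕ s)) ∧_) (avoids-∷ʳ A (p ⊕ s) ss x))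
                                 (sym (∧-assoc (not (A (p ⊕ s))) _ _))

offHUntil-∷ʳ : ∀ q t ss x → offHUntil q t (ss ∷ʳ x) ≡ not (inH q) ∧ (avoids inH q ss ∧ samePt (endpointFrom q ss ⊕ x) t)
offHUntil-∷ʳ q t []       x = refl
offHUntil-∷ʳ q t (s ∷ ss) x = cong (not (inH q) ∧_) (trans (offHUntil-∷ʳ (q ⊕ s) t ss x)
                                                        (sym (∧-assoc (not (inH (q ⊕ s))) _ _)))

entersHAt-∷ʳ : ∀ p t ss x → entersHAt p t (ss ∷ʳ x) ≡ avoids inH p ss ∧ samePt (endpointFrom p ss ⊕ x) t
entersHAt-∷ʳ p t []       x = refl
entersHAt-∷ʳ p t (s ∷ ss) x = trans (offHUntil-∷ʳ (p ⊕ s) t ss x) (sym (∧-assoc (not (inH (p ⊕ s))) _ _))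

slitTo-∷ʳ : ∀ p t ss x → slitTo p t (ss ∷ʳ x) ≡ (avoids inH p ss ∧ not (inH (endpointFrom p ss ⊕ x))) ∧ samePt (endpointFrom p ss ⊕ x) t
slitTo-∷ʳ p t ss x = cong₂ _∧_ (avoids-∷ʳ inH p ss x) (cong (λ e → samePt e t) (endpointFrom-∷ʳ p ss x))

offHUntil⇒endpoint : ∀ q t ss → offHUntil q t ss ≡ true → endpointFrom q ss ≡ t
offHUntil⇒endpoint q t []       reach = samePt⇒≡ reach
offHUntil⇒endpoint q t (s ∷ ss) reach with inH q
... | false = offHUntil⇒endpoint (q ⊕ s) t ss reach

entersHAt⇒endpoint : ∀ p t ss → entersHAt p t ss ≡ true → endpointFrom p ss ≡ t
entersHAt⇒endpoint p t (s ∷ ss) = offHUntil⇒endpoint (p ⊕ s) t ss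

∣endpointFrom∣≤ : ∀ {M} p ss → All (λ x → ∣ proj₁ x ∣ ≤ M) ss → ∣ proj₁ (endpointFrom p ss) ∣ ≤ ∣ proj₁ p ∣ + length ss * M
∣endpointFrom∣≤ p [] [] = m≤m+n _ 0
∣endpointFrom∣≤ {M} p (x ∷ ss) (x≤M ∷ ss≤M) =
  ≤-trans (∣endpointFrom∣≤ (p ⊕ x) ss ss≤M)
    (≤-trans (+-monoˡ-≤ (length ss * M) (≤-trans (∣i+j∣≤∣i∣+∣j∣ (proj₁ p) (proj₁ x)) (+-monoʳ-≤ ∣ proj₁ p ∣ x≤M)))
             (≤-reflexive (+-assoc ∣ proj₁ p ∣ M (length ss * M))))

split-at-H : ∀ b e t → ⟦ b ∧ samePt e t ⟧ ≡ ⟦ (b ∧ not (inH e)) ∧ samePt e t ⟧ + ⟦ inH t ⟧ * ⟦ b ∧ samePt e t ⟧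
split-at-H b e t with samePt e t in e≟t
... | false rewrite ∧-zeroʳ b | ∧-zeroʳ (b ∧ not (inH e)) = sym (*-zeroʳ ⟦ inH t ⟧)
... | true  with refl ← samePt⇒≡ {e} {t} e≟t rewrite ∧-identityʳ b | ∧-identityʳ (b ∧ not (inH e)) = ⟦⟧-split b (inH e)

slitTo-shift : ∀ p t ss x → ⟦ slitTo p (proj₁ t ℤ.- proj₁ x , proj₂ t ℤ.- proj₂ x) ss ⟧
                            ≡ ⟦ slitTo p t (ss ∷ʳ x) ⟧ + ⟦ inH t ⟧ * ⟦ entersHAt p t (ss ∷ʳ x) ⟧
slitTo-shift p t ss x = begin
  ⟦ avoids inH p ss ∧ samePt (endpointFrom p ss) (proj₁ t ℤ.- proj₁ x , proj₂ t ℤ.- proj₂ x) ⟧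
    ≡⟨ cong (λ b → ⟦ avoids inH p ss ∧ b ⟧) (samePt-shift (endpointFrom p ss) x t) ⟩
  ⟦ avoids inH p ss ∧ samePt e t ⟧
    ≡⟨ split-at-H (avoids inH p ss) e t ⟩
  ⟦ (avoids inH p ss ∧ not (inH e)) ∧ samePt e t ⟧ + ⟦ inH t ⟧ * ⟦ avoids inH p ss ∧ samePt e t ⟧
    ≡⟨ sym (cong₂ (λ u v → ⟦ u ⟧ + ⟦ inH t ⟧ * ⟦ v ⟧) (slitTo-∷ʳ p t ss x) (entersHAt-∷ʳ p t ss x)) ⟩
  ⟦ slitTo p t (ss ∷ʳ x) ⟧ + ⟦ inH t ⟧ * ⟦ entersHAt p t (ss ∷ʳ x) ⟧ ∎
  where
  e : Point
  e = endpointFrom p ss ⊕ x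

⟦∧∧⟧ : ∀ a b c → ⟦ a ∧ (b ∧ c) ⟧ ≡ ⟦ b ⟧ * ⟦ a ∧ c ⟧
⟦∧∧⟧ false false c = refl
⟦∧∧⟧ false true  c = refl
⟦∧∧⟧ true  false c = refl
⟦∧∧⟧ true  true  c = sym (+-identityʳ ⟦ c ⟧)

module _ (𝔖 : List Point) where

  private
    m : ℕ
    m = length 𝔖

    step : Fin m → Point
    step = lookup 𝔖

  ∑Walks : ℕ → (List Point → ℕ) → ℕ
  ∑Walks zero    f = f []
  ∑Walks (suc n) f = ∑[ s < m ] ∑Walks n (λ ss → f (step s ∷ ss))

  ∑Walks-allSeqs : ∀ n (f : List Point → ℕ) → sum (map (λ w → f (steps 𝔖 w)) (allSeqs m n)) ≡ ∑Walks n f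
  ∑Walks-allSeqs zero    f = +-identityʳ (f [])
  ∑Walks-allSeqs (suc n) f = begin
    sum (map g (concatMap (λ v → map (λ s → s Vec.∷ v) (allFin m)) (allSeqs m n)))
      ≡⟨ sum-map-concatMap g _ (allSeqs m n) ⟩
    sum (map (λ v → sum (map g (map (λ s → s Vec.∷ v) (allFin m)))) (allSeqs m n))
      ≡⟨ cong sum (map-cong (λ v → trans (cong (sum ∘ map g) (map-tabulate (λ s → s) (λ s → s Vec.∷ v)))
                                         (sum-map-tabulate g (λ s → s Vec.∷ v))) (allSeqs m n)) ⟩
    sum (map (λ v → ∑[ s < m ] g (s Vec.∷ v)) (allSeqs m n))
      ≡⟨ sum-map-∑ (λ v s → g (s Vec.∷ v)) (allSeqs m n) ⟩
    ∑[ s < m ] sum (map (λ v → g (s Vec.∷ v)) (allSeqs m n))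
      ≡⟨ sum-cong-≗ (λ s → ∑Walks-allSeqs n (λ ss → f (step s ∷ ss))) ⟩
    ∑Walks (suc n) f ∎
    where
    g : Walk 𝔖 (suc n) → ℕ
    g w = f (steps 𝔖 w)

  count≡∑Walks : ∀ n (P : List Point → Bool) → length (filterᵇ (λ w → P (steps 𝔖 w)) (allSeqs m n)) ≡ ∑Walks n (⟦_⟧ ∘ P)
  count≡∑Walks n P = trans (length-filterᵇ _ (allSeqs m n)) (∑Walks-allSeqs n (⟦_⟧ ∘ P))

  ∑Walks-cong : ∀ n {f g} → (∀ ss → f ss ≡ g ss) → ∑Walks n f ≡ ∑Walks n g
  ∑Walks-cong zero    f≗g = f≗g []
  ∑Walks-cong (suc n) f≗g = sum-cong-≗ (λ s → ∑Walks-cong n (λ ss → f≗g (step s ∷ ss)))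

  ∑Walks-distrib-+ : ∀ n f g → ∑Walks n (λ ss → f ss + g ss) ≡ ∑Walks n f + ∑Walks n g
  ∑Walks-distrib-+ zero    f g = refl
  ∑Walks-distrib-+ (suc n) f g =
    trans (sum-cong-≗ (λ s → ∑Walks-distrib-+ n (f ∘ (step s ∷_)) (g ∘ (step s ∷_))))
          (∑-distrib-+ (λ s → ∑Walks n (f ∘ (step s ∷_))) (λ s → ∑Walks n (g ∘ (step s ∷_))))

  ∑Walks-*ˡ : ∀ n c f → ∑Walks n (λ ss → c * f ss) ≡ c * ∑Walks n f
  ∑Walks-*ˡ zero    c f = refl
  ∑Walks-*ˡ (suc n) c f = trans (sum-cong-≗ (λ s → ∑Walks-*ˡ n c (f ∘ (step s ∷_))))
                                (sym (*-distribˡ-sum c (λ s → ∑Walks n (f ∘ (step s ∷_)))))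

  ∑Walks-∷ʳ : ∀ n f → ∑Walks (suc n) f ≡ ∑[ s < m ] ∑Walks n (λ ss → f (ss ∷ʳ step s))
  ∑Walks-∷ʳ zero    f = refl
  ∑Walks-∷ʳ (suc n) f = trans (sum-cong-≗ (λ s → ∑Walks-∷ʳ n (λ ss → f (step s ∷ ss)))) (∑-comm (λ s s′ → ∑Walks n (λ ss → f (step s ∷ ss ∷ʳ step s′))))

  ∑Walks-vanish : ∀ {Q : Point → Set} → (∀ s → Q (step s)) →
                  ∀ n {f} → (∀ ss → All Q ss → length ss ≡ n → f ss ≡ 0) → ∑Walks n f ≡ 0
  ∑Walks-vanish Q-step zero    f≡0 = f≡0 [] [] refl
  ∑Walks-vanish Q-step (suc n) f≡0 =
    trans (sum-cong-≗ (λ s → ∑Walks-vanish Q-step n (λ ss Q-ss ∣ss∣≡n → f≡0 (step s ∷ ss) (Q-step s ∷ Q-ss) (cong suc ∣ss∣≡n))))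
          (sum-replicate-zero m)

  ω : ℕ → ℕ → ℕ
  ω n k = ∑Walks n (⟦_⟧ ∘ entersHAt origin (ℤ.- (ℤ.+ k) , 0ℤ))

  widthBound : ℕ
  widthBound = ∑[ s < m ] ∣ proj₁ (step s) ∣

  ω-vanishes : ∀ n k → n * widthBound < k → ω n k ≡ 0
  ω-vanishes n k n*width<k = ∑Walks-vanish (f≤∑f (λ s → ∣ proj₁ (step s) ∣)) n vanish
    where
    vanish : ∀ ss → All (λ x → ∣ proj₁ x ∣ ≤ widthBound) ss → length ss ≡ n → ⟦ entersHAt origin (ℤ.- (ℤ.+ k) , 0ℤ) ss ⟧ ≡ 0
    vanish ss small ∣ss∣≡n with entersHAt origin (ℤ.- (ℤ.+ k) , 0ℤ) ss in enters
    ... | false = refl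
    ... | true  = contradiction k≤n*width (<⇒≱ n*width<k)
      where
      ∣end∣≡k : ∣ proj₁ (endpointFrom origin ss) ∣ ≡ k
      ∣end∣≡k = trans (cong (∣_∣ ∘ proj₁) (entersHAt⇒endpoint origin _ ss enters)) (∣-i∣≡∣i∣ (ℤ.+ k))
      k≤n*width : k ≤ n * widthBound
      k≤n*width = subst₂ _≤_ ∣end∣≡k (cong (_* widthBound) ∣ss∣≡n) (∣endpointFrom∣≤ origin ss small)

  ω-finiteSupport : ∀ n → ∃[ N ] (∀ k → N ≤ k → ω n k ≡ 0)
  ω-finiteSupport n = suc (n * widthBound) , ω-vanishes n

  slitCount≡∑Walks : ∀ n i j → slitCount 𝔖 n i j ≡ ∑Walks n (⟦_⟧ ∘ slitTo origin (i , j))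
  slitCount≡∑Walks n i j = count≡∑Walks n (slitTo origin (i , j))

  ⟦inH⟧*entries≡ω : ∀ n t → ⟦ inH t ⟧ * ∑Walks n (⟦_⟧ ∘ entersHAt origin t) ≡ ⟦ inH t ⟧ * ω n ∣ proj₁ t ∣
  ⟦inH⟧*entries≡ω n t with inH t in t∈H
  ... | false = refl
  ... | true  = cong (λ u → 1 * ∑Walks n (⟦_⟧ ∘ entersHAt origin u)) (inH⇒≡ {t} t∈H)

  ∑-slitCount-shift : ∀ n i j → ∑[ s < m ] slitCount 𝔖 n (i ℤ.- proj₁ (step s)) (j ℤ.- proj₂ (step s))
                              ≡ slitCount 𝔖 (suc n) i j + ⟦ inH (i , j) ⟧ * ω (suc n) ∣ i ∣
  ∑-slitCount-shift n i j = begin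
    ∑[ s < m ] slitCount 𝔖 n (i ℤ.- proj₁ (step s)) (j ℤ.- proj₂ (step s))
      ≡⟨ sum-cong-≗ (λ s → trans (slitCount≡∑Walks n _ _) (∑Walks-cong n (λ ss → slitTo-shift origin t ss (step s)))) ⟩
    ∑[ s < m ] ∑Walks n (λ ss → F (ss ∷ʳ step s))
      ≡⟨ sym (∑Walks-∷ʳ n F) ⟩
    ∑Walks (suc n) F
      ≡⟨ ∑Walks-distrib-+ (suc n) (⟦_⟧ ∘ slitTo origin t) (λ ss → ⟦ inH t ⟧ * ⟦ entersHAt origin t ss ⟧) ⟩
    ∑Walks (suc n) (⟦_⟧ ∘ slitTo origin t) + ∑Walks (suc n) (λ ss → ⟦ inH t ⟧ * ⟦ entersHAt origin t ss ⟧)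
      ≡⟨ cong₂ _+_ (sym (slitCount≡∑Walks (suc n) i j))
                   (trans (∑Walks-*ˡ (suc n) ⟦ inH t ⟧ (⟦_⟧ ∘ entersHAt origin t)) (⟦inH⟧*entries≡ω (suc n) t)) ⟩
    slitCount 𝔖 (suc n) i j + ⟦ inH t ⟧ * ω (suc n) ∣ i ∣ ∎
    where
    t : Point
    t = (i , j)
    F : List Point → ℕ
    F ss = ⟦ slitTo origin t ss ⟧ + ⟦ inH t ⟧ * ⟦ entersHAt origin t ss ⟧

  KSCoeff≡1-Ω : ∀ n i j → KSCoeff 𝔖 n i j ≡ oneMinusΩCoeff ω n i j
  KSCoeff≡1-Ω zero i j = begin
    ℤ.+ slitCount 𝔖 0 i j               ≡⟨ cong ℤ.+_ (slitCount≡∑Walks 0 i j) ⟩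
    ℤ.+ ⟦ samePt origin (i , j) ⟧       ≡⟨ cong (ℤ.+_ ∘ ⟦_⟧) (samePt-sym origin (i , j)) ⟩
    ℤ.+ ⟦ samePt (i , j) origin ⟧       ≡⟨ constant-term (samePt (i , j) origin) (inH (i , j)) ⟩
    oneMinusΩCoeff ω 0 i j              ∎
    where
    constant-term : ∀ b h → ℤ.+ ⟦ b ⟧ ≡ (if b ∧ true then ℤ.+ 1 else 0ℤ) ℤ.- (if h then ℤ.+ 0 else 0ℤ)
    constant-term false false = refl
    constant-term false true  = refl
    constant-term true  false = refl
    constant-term true  true  = refl
  KSCoeff≡1-Ω (suc n) i j = begin
    KSCoeff 𝔖 (suc n) i j
      ≡⟨ cong (λ z → ℤ.+ a ℤ.- z) (trans (sumℤ-map-+ shifted 𝔖) (cong ℤ.+_ (sum-map-lookup shifted 𝔖))) ⟩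
    ℤ.+ a ℤ.- ℤ.+ ∑[ s < m ] slitCount 𝔖 n (i ℤ.- proj₁ (step s)) (j ℤ.- proj₂ (step s))
      ≡⟨ cong (λ z → ℤ.+ a ℤ.- ℤ.+ z) (∑-slitCount-shift n i j) ⟩
    ℤ.+ a ℤ.- ℤ.+ (a + w)
      ≡⟨ cong (λ z → ℤ.+ a ℤ.- z) (pos-+ a w) ⟩
    ℤ.+ a ℤ.- (ℤ.+ a ℤ.+ ℤ.+ w)
      ≡⟨ cancel (ℤ.+ a) (ℤ.+ w) ⟩
    0ℤ ℤ.- ℤ.+ w
      ≡⟨ cong (λ z → 0ℤ ℤ.- z) (+⟦⟧*≡if (inH (i , j)) (ω (suc n) ∣ i ∣)) ⟩
    0ℤ ℤ.- (if inH (i , j) then ℤ.+ ω (suc n) ∣ i ∣ else 0ℤ)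
      ≡⟨ cong (λ b → (if b then ℤ.+ 1 else 0ℤ) ℤ.- (if inH (i , j) then ℤ.+ ω (suc n) ∣ i ∣ else 0ℤ))
              (sym (∧-zeroʳ (samePt (i , j) origin))) ⟩
    oneMinusΩCoeff ω (suc n) i j ∎
    where
    shifted : Point → ℕ
    shifted x = slitCount 𝔖 n (i ℤ.- proj₁ x) (j ℤ.- proj₂ x)
    a w : ℕ
    a = slitCount 𝔖 (suc n) i j
    w = ⟦ inH (i , j) ⟧ * ω (suc n) ∣ i ∣
    cancel : ∀ x y → x ℤ.- (x ℤ.+ y) ≡ 0ℤ ℤ.- y
    cancel = ℤ-Solver.solve-∀

  loops : ℕ → Point → ℕ
  loops n p = ∑Walks n (⟦_⟧ ∘ loopFrom p)

  loops₀ : ℕ → ℕ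
  loops₀ n = loops n origin

  entries : ℕ → Point → ℕ
  entries n p = ∑Walks n (⟦_⟧ ∘ entersHAt p origin)

  arrivals : ℕ → Point → ℕ
  arrivals n q = ∑Walks n (⟦_⟧ ∘ offHUntil q origin)

  loops-suc : ∀ n p → loops (suc n) p ≡ ∑[ s < m ] (⟦ not (inNegAxis (p ⊕ step s)) ⟧ * loops n (p ⊕ step s))
  loops-suc n p = sum-cong-≗ (λ s → first-step (step s))
    where
    first-step : ∀ x → ∑Walks n (λ ss → ⟦ loopFrom p (x ∷ ss) ⟧) ≡ ⟦ not (inNegAxis (p ⊕ x)) ⟧ * loops n (p ⊕ x)
    first-step x = trans (∑Walks-cong n (λ ss → ⟦∧∧⟧ (samePt (endpointFrom (p ⊕ x) ss) origin) (not (inNegAxis (p ⊕ x))) (avoids inNegAxis (p ⊕ x) ss)))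
                         (∑Walks-*ˡ n ⟦ not (inNegAxis (p ⊕ x)) ⟧ (⟦_⟧ ∘ loopFrom (p ⊕ x)))

  arrivals-split : ∀ n q → arrivals n q ≡ ⟦ samePt q origin ⟧ * ⟦ n ≡ᵇ 0 ⟧ + ⟦ not (inH q) ⟧ * entries n q
  arrivals-split zero    q = arith ⟦ samePt q origin ⟧ ⟦ not (inH q) ⟧
    where
    arith : ∀ a b → a ≡ a * 1 + b * 0
    arith = solve-∀
  arrivals-split (suc n) q = begin
    arrivals (suc n) q
      ≡⟨ sum-cong-≗ (λ s → trans (∑Walks-cong n (λ ss → ⟦∧⟧ (not (inH q)) (offHUntil (q ⊕ step s) origin ss)))
                                 (∑Walks-*ˡ n ⟦ not (inH q) ⟧ (⟦_⟧ ∘ offHUntil (q ⊕ step s) origin))) ⟩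
    ∑[ s < m ] (⟦ not (inH q) ⟧ * arrivals n (q ⊕ step s))
      ≡⟨ sym (*-distribˡ-sum ⟦ not (inH q) ⟧ (λ s → arrivals n (q ⊕ step s))) ⟩
    ⟦ not (inH q) ⟧ * entries (suc n) q
      ≡⟨ cong (_+ ⟦ not (inH q) ⟧ * entries (suc n) q) (sym (*-zeroʳ ⟦ samePt q origin ⟧)) ⟩
    ⟦ samePt q origin ⟧ * 0 + ⟦ not (inH q) ⟧ * entries (suc n) q ∎

  ⋆-arrivals : ∀ n q → (loops₀ ⋆ (λ j → arrivals j q)) n
                       ≡ ⟦ samePt q origin ⟧ * loops₀ n + ⟦ not (inH q) ⟧ * (loops₀ ⋆ (λ j → entries j q)) n
  ⋆-arrivals n q = begin
    (loops₀ ⋆ (λ j → arrivals j q)) n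
      ≡⟨ ⋆-cong (λ _ → refl) (λ j → arrivals-split j q) n ⟩
    (loops₀ ⋆ (λ j → ⟦ samePt q origin ⟧ * ⟦ j ≡ᵇ 0 ⟧ + ⟦ not (inH q) ⟧ * entries j q)) n
      ≡⟨ ⋆-linearʳ loops₀ (λ j → ⟦ j ≡ᵇ 0 ⟧) (λ j → entries j q) ⟦ samePt q origin ⟧ ⟦ not (inH q) ⟧ n ⟩
    ⟦ samePt q origin ⟧ * (loops₀ ⋆ (λ j → ⟦ j ≡ᵇ 0 ⟧)) n + ⟦ not (inH q) ⟧ * (loops₀ ⋆ (λ j → entries j q)) n
      ≡⟨ cong (λ z → ⟦ samePt q origin ⟧ * z + ⟦ not (inH q) ⟧ * (loops₀ ⋆ (λ j → entries j q)) n) (⋆-identityʳ loops₀ n) ⟩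
    ⟦ samePt q origin ⟧ * loops₀ n + ⟦ not (inH q) ⟧ * (loops₀ ⋆ (λ j → entries j q)) n ∎

  FirstPassage : ℕ → Point → Set
  FirstPassage n p = loops n p ≡ ⟦ samePt p origin ∧ (n ≡ᵇ 0) ⟧ + (loops₀ ⋆ (λ k → entries k p)) n

  firstPassage-step : ∀ n q → FirstPassage n q →
    ⟦ not (inNegAxis q) ⟧ * loops n q ≡ ⟦ samePt q origin ⟧ * loops₀ n + ⟦ not (inH q) ⟧ * (loops₀ ⋆ (λ k → entries k q)) n
  -- For q = origin both sides are loops₀ n; for any other q, lying on the negative half-axis
  -- is the same as lying in H.
  firstPassage-step n q ih with samePt q origin in q≟0
  ... | true  with refl ← samePt⇒≡ {q} {origin} q≟0 = sym (+-identityʳ (1 * loops₀ n))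
  ... | false rewrite inNegAxis≡inH {q} q≟0 = cong (⟦ not (inH q) ⟧ *_) ih

  firstPassage : ∀ n p → FirstPassage n p
  firstPassage zero    p = sym (trans (cong (at-origin +_) (*-zeroʳ (loops₀ 0))) (+-identityʳ at-origin))
    where
    at-origin : ℕ
    at-origin = ⟦ samePt p origin ∧ true ⟧
  firstPassage (suc n) p rewrite ∧-zeroʳ (samePt p origin) = begin
    loops (suc n) p
      ≡⟨ loops-suc n p ⟩
    ∑[ s < m ] (⟦ not (inNegAxis (p ⊕ step s)) ⟧ * loops n (p ⊕ step s))
      ≡⟨ sum-cong-≗ (λ s → trans (firstPassage-step n (p ⊕ step s) (firstPassage n (p ⊕ step s)))
                                 (sym (⋆-arrivals n (p ⊕ step s)))) ⟩
    ∑[ s < m ] (loops₀ ⋆ (λ j → arrivals j (p ⊕ step s))) n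
      ≡⟨ sym (⋆-∑ʳ loops₀ (λ s j → arrivals j (p ⊕ step s)) n) ⟩
    (loops₀ ⋆ (λ j → entries (suc j) p)) n
      ≡⟨ sym (trans (cong (rest +_) (*-zeroʳ (loops₀ (suc n)))) (+-identityʳ rest)) ⟩
    (loops₀ ⋆ (λ j → entries (suc j) p)) n + loops₀ (suc n) * 0
      ≡⟨ sym (⋆-sucʳ loops₀ (λ k → entries k p) n) ⟩
    (loops₀ ⋆ (λ k → entries k p)) (suc n) ∎
    where
    rest : ℕ
    rest = (loops₀ ⋆ (λ j → entries (suc j) p)) n

  loopCount≡loops₀ : ∀ n → loopCount 𝔖 n ≡ loops₀ n
  loopCount≡loops₀ n = count≡∑Walks n (loopFrom origin)

  loopCount-recurrence : ∀ n → loopCount 𝔖 n ≡ (if n ≡ᵇ 0 then 1 else 0)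
                                               + sum (map (λ k → loopCount 𝔖 k * ω (n ∸ k) 0) (upTo (suc n)))
  loopCount-recurrence n = begin
    loopCount 𝔖 n
      ≡⟨ loopCount≡loops₀ n ⟩
    loops₀ n
      ≡⟨ firstPassage n origin ⟩
    ⟦ n ≡ᵇ 0 ⟧ + (loops₀ ⋆ (λ k → entries k origin)) n
      ≡⟨ cong (⟦ n ≡ᵇ 0 ⟧ +_) (⋆-cong (sym ∘ loopCount≡loops₀) (λ _ → refl) n) ⟩
    ⟦ n ≡ᵇ 0 ⟧ + (loopCount 𝔖 ⋆ (λ k → ω k 0)) n
      ≡⟨ cong (⟦ n ≡ᵇ 0 ⟧ +_) (sym (sum-upTo≡⋆ (loopCount 𝔖) (λ k → ω k 0) n)) ⟩
    ⟦ n ≡ᵇ 0 ⟧ + sum (map (λ k → loopCount 𝔖 k * ω (n ∸ k) 0) (upTo (suc n))) ∎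

lemma6p1 : (𝔖 : List Point) → Unique 𝔖 →
    Σ[ ω ∈ (ℕ → ℕ → ℕ) ]
      ((∀ k → ω 0 k ≡ 0)
      × (∀ n → ∃[ N ] (∀ k → N ≤ k → ω n k ≡ 0))
      × (∀ (n : ℕ) (i j : ℤ) → KSCoeff 𝔖 n i j ≡ oneMinusΩCoeff ω n i j)
      × (∀ n → loopCount 𝔖 n ≡ (if n Data.Nat.≡ᵇ 0 then 1 else 0)
                  + sum (map (λ k → loopCount 𝔖 k * ω (n ∸ k) 0) (upTo (suc n)))))
lemma6p1 𝔖 _ = ω 𝔖 , (λ _ → refl) , ω-finiteSupport 𝔖 , KSCoeff≡1-Ω 𝔖 , loopCount-recurrence 𝔖
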